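{- Let $(w,p,W)$ be a 0-1-Knapsack instance with $n$ items and distinct profit-to-weight ratios $p_1/w_1 > \dots > p_n/w_n$, and let $x^*$ be an optimal solution. Then there are no non-empty sets $A \subseteq \{i \in [n] : x^*_i = 0\}$ and $B \subseteq \{i \in [n] : x^*_i = 1\}$ with $\max(A) < \min(B)$ and $\sum_{i \in A} w_i = \sum_{i \in B} w_i$.
   Context: 0-1-Knapsack: given profits $p \in \mathbb{N}^n$, weights $w \in \mathbb{N}^n$ and budget $W \in \mathbb{N}$, compute $\max\{p^T x : w^T x \le W,\ x \in \{0,1\}^n\}$; an optimal solution is a maximizer $x^*$. -}

module Defs where

open import Data.Nat using (ℕ; zero; suc; _+_; _*_; _≤_; _<_)
open import Data.Fin using (Fin) renaming (_<_ to _<ᶠ_)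
open import Data.Bool using (Bool; true; false; if_then_else_)
open import Data.Product using (_×_; ∃)
open import Relation.Binary.PropositionalEquality using (_≡_)
open import Data.Fin.Subset using (Subset; _∈_; _⊆_)
open import Data.Vec using (Vec; lookup)

sumFin : ∀ {n} → (Fin n → ℕ) → ℕ
sumFin {zero}  f = 0
sumFin {suc n} f = f Fin.zero + sumFin (λ i → f (Fin.suc i))
  where import Data.Fin as Fin

_·_ : ∀ {n} → (Fin n → ℕ) → (Fin n → Bool) → ℕ
v · x = sumFin (λ i → if x i then v i else 0)

sumOver : ∀ {n} → Subset n → (Fin n → ℕ) → ℕ
sumOver S v = sumFin (λ i → if lookup S i then v i else 0)

Feasible : ∀ {n} → (w : Fin n → ℕ) → (W : ℕ) → (x : Fin n → Bool) → Set
Feasible w W x = w · x ≤ W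

Optimal : ∀ {n} → (w p : Fin n → ℕ) → (W : ℕ) → (x : Fin n → Bool) → Set
Optimal w p W x =
  Feasible w W x × (∀ y → Feasible w W y → p · y ≤ p · x)

-- p_i / w_i > p_j / w_j for positive weights, i.e. p_i * w_j > p_j * w_i
RatioGreater : ∀ {n} → (w p : Fin n → ℕ) → Fin n → Fin n → Set
RatioGreater w p i j = p j * w i < p i * w j

StrictlyDecreasingRatios : ∀ {n} → (w p : Fin n → ℕ) → Set
StrictlyDecreasingRatios w p = ∀ i j → i <ᶠ j → RatioGreater w p i j

NonEmpty : ∀ {n} → Subset n → Set
NonEmpty S = ∃ λ i → i ∈ S

levelSet : ∀ {n} → (Fin n → Bool) → Bool → Subset n
levelSet x b = Data.Vec.tabulate (λ i → x i ≡ᵇ b)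
  where
    import Data.Vec
    _≡ᵇ_ : Bool → Bool → Bool
    true  ≡ᵇ true  = true
    false ≡ᵇ false = true
    _     ≡ᵇ _     = false

-- max(A) < min(B) for non-empty A, B: every element of A is below every element of B
MaxBelowMin : ∀ {n} → Subset n → Subset n → Set
MaxBelowMin A B = ∀ a b → a ∈ A → b ∈ B → a <ᶠ b

{-# OPTIONS --safe #-}
-- Exchanging A (unpacked items) for B (packed items) keeps the total weight,
-- since A and B weigh the same.  Every ratio in A beats every ratio in B, so
-- summing p_b w_a < p_a w_b over A × B gives w(A) p(B) < p(A) w(B), and
-- cancelling w(A) = w(B) shows that the exchange strictly increases the
-- profit, contradicting optimality.
module Submission where

open import Defs
open import Data.Nat using (ℕ; zero; suc; _+_; _*_; _≤_; _<_; z≤n)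
open import Data.Nat.Properties
open import Algebra.Properties.CommutativeSemigroup +-commutativeSemigroup using (interchange)
open import Data.Fin using (Fin)
import Data.Fin as Fin
open import Data.Bool using (Bool; true; false; if_then_else_)
open import Data.Product using (_×_; ∃₂; _,_)
open import Data.Fin.Subset using (Subset; _⊆_; _∈_)
open import Data.Vec using (lookup)
open import Data.Vec.Properties using ([]=⇒lookup; lookup⇒[]=; lookup∘tabulate)
open import Relation.Nullary using (¬_)
open import Relation.Binary.PropositionalEquality

private
  variable
    m n : ℕ

sumFin-cong : (f g : Fin n → ℕ) → (∀ i → f i ≡ g i) → sumFin f ≡ sumFin g
sumFin-cong {zero}  f g f≡g = refl
sumFin-cong {suc n} f g f≡g =
  cong₂ _+_ (f≡g Fin.zero) (sumFin-cong (λ i → f (Fin.suc i)) (λ i → g (Fin.suc i)) (λ i → f≡g (Fin.suc i)))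

sumFin-mono-≤ : (f g : Fin n → ℕ) → (∀ i → f i ≤ g i) → sumFin f ≤ sumFin g
sumFin-mono-≤ {zero}  f g f≤g = z≤n
sumFin-mono-≤ {suc n} f g f≤g =
  +-mono-≤ (f≤g Fin.zero) (sumFin-mono-≤ (λ i → f (Fin.suc i)) (λ i → g (Fin.suc i)) (λ i → f≤g (Fin.suc i)))

sumFin-mono-< : (f g : Fin n → ℕ) → (∀ i → f i ≤ g i) → ∀ j → f j < g j → sumFin f < sumFin g
sumFin-mono-< {suc n} f g f≤g Fin.zero    fj<gj =
  +-mono-<-≤ fj<gj (sumFin-mono-≤ (λ i → f (Fin.suc i)) (λ i → g (Fin.suc i)) (λ i → f≤g (Fin.suc i)))
sumFin-mono-< {suc n} f g f≤g (Fin.suc j) fj<gj =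
  +-mono-≤-< (f≤g Fin.zero) (sumFin-mono-< (λ i → f (Fin.suc i)) (λ i → g (Fin.suc i)) (λ i → f≤g (Fin.suc i)) j fj<gj)

sumFin-+ : (f g : Fin n → ℕ) → sumFin (λ i → f i + g i) ≡ sumFin f + sumFin g
sumFin-+ {zero}  f g = refl
sumFin-+ {suc n} f g = begin
  f Fin.zero + g Fin.zero + sumFin (λ i → f (Fin.suc i) + g (Fin.suc i))
    ≡⟨ cong (f Fin.zero + g Fin.zero +_) (sumFin-+ (λ i → f (Fin.suc i)) (λ i → g (Fin.suc i))) ⟩
  f Fin.zero + g Fin.zero + (sumFin (λ i → f (Fin.suc i)) + sumFin (λ i → g (Fin.suc i)))
    ≡⟨ interchange (f Fin.zero) (g Fin.zero) _ _ ⟩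
  sumFin f + sumFin g ∎
  where open ≡-Reasoning

sumFin-*ˡ : (c : ℕ) (f : Fin n → ℕ) → sumFin (λ i → c * f i) ≡ c * sumFin f
sumFin-*ˡ {zero}  c f = sym (*-zeroʳ c)
sumFin-*ˡ {suc n} c f =
  trans (cong (c * f Fin.zero +_) (sumFin-*ˡ c (λ i → f (Fin.suc i))))
        (sym (*-distribˡ-+ c (f Fin.zero) _))

sumFin-*-sumFin : (f : Fin m → ℕ) (g : Fin n → ℕ) →
                  sumFin (λ a → sumFin (λ b → f a * g b)) ≡ sumFin f * sumFin g
sumFin-*-sumFin f g = begin
  sumFin (λ a → sumFin (λ b → f a * g b)) ≡⟨ sumFin-cong _ _ (λ a → sumFin-*ˡ (f a) g) ⟩
  sumFin (λ a → f a * sumFin g)           ≡⟨ sumFin-cong _ _ (λ a → *-comm (f a) (sumFin g)) ⟩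
  sumFin (λ a → sumFin g * f a)           ≡⟨ sumFin-*ˡ (sumFin g) f ⟩
  sumFin g * sumFin f                     ≡⟨ *-comm (sumFin g) (sumFin f) ⟩
  sumFin f * sumFin g                     ∎
  where open ≡-Reasoning

sumFin-*-mono-< : (f h : Fin m → ℕ) (g k : Fin n → ℕ) →
                  (∀ a b → f a * g b ≤ h a * k b) →
                  ∀ a b → f a * g b < h a * k b →
                  sumFin f * sumFin g < sumFin h * sumFin k
sumFin-*-mono-< f h g k ≤-everywhere a b <-at-ab =
  subst₂ _<_ (sumFin-*-sumFin f g) (sumFin-*-sumFin h k)
    (sumFin-mono-< _ _ (λ a′ → sumFin-mono-≤ _ _ (≤-everywhere a′)) a
      (sumFin-mono-< _ _ (≤-everywhere a) b <-at-ab))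

∈-levelSet⇒≡ : (x : Fin n → Bool) (b : Bool) {i : Fin n} → i ∈ levelSet x b → x i ≡ b
∈-levelSet⇒≡ x b {i} i∈ with x i | b | trans (sym (lookup∘tabulate _ i)) ([]=⇒lookup i∈)
... | true  | true  | _ = refl
... | false | false | _ = refl
... | true  | false | ()
... | false | true  | ()

exchangeBit : (inA inB old : Bool) → Bool
exchangeBit true  _     _   = true
exchangeBit false true  _   = false
exchangeBit false false old = old

exchange : Subset n → Subset n → (Fin n → Bool) → Fin n → Bool
exchange A B x i = exchangeBit (lookup A i) (lookup B i) (x i)

exchangeBit-balance : (inA inB old : Bool) (v : ℕ) →
                      (inA ≡ true → old ≡ false) → (inB ≡ true → old ≡ true) →
                      (if old then v else 0) + (if inA then v else 0)
                        ≡ (if exchangeBit inA inB old then v else 0) + (if inB then v else 0)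
exchangeBit-balance true  _     true  v A⇒unpacked _ with () ← A⇒unpacked refl
exchangeBit-balance true  true  false v _ B⇒packed with () ← B⇒packed refl
exchangeBit-balance true  false false v _ _ = +-comm 0 v
exchangeBit-balance false true  true  v _ _ = +-comm v 0
exchangeBit-balance false true  false v _ B⇒packed with () ← B⇒packed refl
exchangeBit-balance false false old   v _ _ = refl

exchange-balance : (x : Fin n → Bool) (A B : Subset n) →
                   A ⊆ levelSet x false → B ⊆ levelSet x true →
                   (v : Fin n → ℕ) → v · x + sumOver A v ≡ v · exchange A B x + sumOver B v
exchange-balance x A B A⊆unpacked B⊆packed v = begin
  v · x + sumOver A v
    ≡⟨ sumFin-+ (λ i → if x i then v i else 0) (λ i → if lookup A i then v i else 0) ⟨
  sumFin (λ i → (if x i then v i else 0) + (if lookup A i then v i else 0))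
    ≡⟨ sumFin-cong _ _ balance ⟩
  sumFin (λ i → (if exchange A B x i then v i else 0) + (if lookup B i then v i else 0))
    ≡⟨ sumFin-+ (λ i → if exchange A B x i then v i else 0) (λ i → if lookup B i then v i else 0) ⟩
  v · exchange A B x + sumOver B v ∎
  where
  open ≡-Reasoning
  balance : ∀ i → (if x i then v i else 0) + (if lookup A i then v i else 0)
                ≡ (if exchange A B x i then v i else 0) + (if lookup B i then v i else 0)
  balance i = exchangeBit-balance (lookup A i) (lookup B i) (x i) (v i)
    (λ i∈A → ∈-levelSet⇒≡ x false (A⊆unpacked (lookup⇒[]= i A i∈A)))
    (λ i∈B → ∈-levelSet⇒≡ x true (B⊆packed (lookup⇒[]= i B i∈B)))

sumOver-ratio-< : (w p : Fin n → ℕ) (A B : Subset n) →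
                  (∀ a b → a ∈ A → b ∈ B → RatioGreater w p a b) →
                  NonEmpty A → NonEmpty B →
                  sumOver A w * sumOver B p < sumOver A p * sumOver B w
sumOver-ratio-< w p A B A≻B (a , a∈A) (b , b∈B) =
  sumFin-*-mono-< _ _ _ _ cross-≤ a b cross-<
  where
  ratio : ∀ {a b} → a ∈ A → b ∈ B → w a * p b < p a * w b
  ratio {a} {b} a∈A b∈B = subst (_< p a * w b) (*-comm (p b) (w a)) (A≻B a b a∈A b∈B)

  cross-≤ : ∀ a b → (if lookup A a then w a else 0) * (if lookup B b then p b else 0)
                  ≤ (if lookup A a then p a else 0) * (if lookup B b then w b else 0)
  cross-≤ a b with lookup A a in a∈A | lookup B b in b∈B
  ... | true  | true  = <⇒≤ (ratio (lookup⇒[]= a A a∈A) (lookup⇒[]= b B b∈B))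
  ... | true  | false = ≤-reflexive (trans (*-zeroʳ (w a)) (sym (*-zeroʳ (p a))))
  ... | false | _     = z≤n

  cross-< : (if lookup A a then w a else 0) * (if lookup B b then p b else 0)
          < (if lookup A a then p a else 0) * (if lookup B b then w b else 0)
  cross-< rewrite []=⇒lookup a∈A | []=⇒lookup b∈B = ratio a∈A b∈B

lemma4p4 : (n : ℕ) (w p : Fin n → ℕ) (W : ℕ)
    → (∀ i → 1 ≤ w i)
    → StrictlyDecreasingRatios w p
    → (x : Fin n → Bool) → Optimal w p W x
    → ¬ (∃₂ λ (A B : Subset n) →
           A ⊆ levelSet x false × B ⊆ levelSet x true
           × NonEmpty A × NonEmpty B
           × MaxBelowMin A B
           × sumOver A w ≡ sumOver B w)
lemma4p4 n w p W _ decreasing x (feasible , optimal)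
         (A , B , A⊆unpacked , B⊆packed , A≢∅ , B≢∅ , A<B , wA≡wB) =
  <⇒≱ profit-increases (optimal y y-feasible)
  where
  y : Fin n → Bool
  y = exchange A B x

  y-feasible : Feasible w W y
  y-feasible = ≤-trans (≤-reflexive (+-cancelʳ-≡ _ _ _ (begin
      w · y + sumOver B w ≡⟨ exchange-balance x A B A⊆unpacked B⊆packed w ⟨
      w · x + sumOver A w ≡⟨ cong (w · x +_) wA≡wB ⟩
      w · x + sumOver B w ∎)))
    feasible
    where open ≡-Reasoning

  pB<pA : sumOver B p < sumOver A p
  pB<pA = *-cancelˡ-< (sumOver A w) _ _
    (subst (sumOver A w * sumOver B p <_)
           (trans (*-comm (sumOver A p) _) (cong (_* sumOver A p) (sym wA≡wB)))
           (sumOver-ratio-< w p A B (λ a b a∈A b∈B → decreasing a b (A<B a b a∈A b∈B)) A≢∅ B≢∅))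

  profit-increases : p · x < p · y
  profit-increases = +-cancelʳ-< (sumOver B p) (p · x) (p · y)
    (subst (p · x + sumOver B p <_) (exchange-balance x A B A⊆unpacked B⊆packed p)
           (+-monoʳ-< (p · x) pB<pA))
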